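{- Let $s,n,t$ be positive integers with $t\geq 2$. Then $r(sK_{2},F_{t,n})=\max\{s,n\}+(t-1)n+s$.
   Context: For graphs $G,H$, the Ramsey number $r(G,H)$ is the least integer $r$ such that every red/blue edge-coloring of the complete graph $K_r$ contains a red copy of $G$ or a blue copy of $H$. $sK_2$ is the disjoint union of $s$ edges (a matching of size $s$). The generalized fan $F_{t,n}$ is $K_1+nK_t$, the join of a single vertex with the disjoint union of $n$ copies of $K_t$. -}

module Defs where

open import Data.Nat using (ℕ; _<_)
open import Data.Fin using (Fin)
open import Data.Bool using (Bool)
open import Data.Maybe using (Maybe; just; nothing)
open import Data.Product using (Σ; _×_; _,_)
open import Data.Sum using (_⊎_)
open import Data.Empty using (⊥)
open import Data.Unit using (⊤)
open import Relation.Nullary using (¬_)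
open import Relation.Binary.PropositionalEquality using (_≡_; _≢_)
open import Function.Definitions using (Injective)

-- A (simple) graph: a vertex type and an adjacency relation
-- (all graphs below have symmetric, irreflexive adjacency).
record Graph : Set₁ where
  field
    V   : Set
    Adj : V → V → Set
open Graph public

data Colour : Set where
  red blue : Colour

record Colouring (r : ℕ) : Set where
  field
    col : Fin r → Fin r → Colour
    sym : ∀ i j → col i j ≡ col j i
open Colouring public

MonoCopy : (r : ℕ) → Colouring r → Colour → Graph → Set
MonoCopy r c k G =
  Σ (V G → Fin r) λ f →
    Injective _≡_ _≡_ f × (∀ u v → Adj G u v → col c (f u) (f v) ≡ k)

Arrows : ℕ → Graph → Graph → Set
Arrows r G H = (c : Colouring r) → MonoCopy r c red G ⊎ MonoCopy r c blue H

IsRamseyNumber : Graph → Graph → ℕ → Set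
IsRamseyNumber G H r = Arrows r G H × (∀ m → m < r → ¬ Arrows m G H)

matching : ℕ → Graph
matching s = record
  { V = Fin s × Bool
  ; Adj = λ { (i , a) (j , b) → i ≡ j × a ≢ b } }

-- F_{t,n} = K_1 + n K_t : centre 'nothing'; vertex just (i , a) is vertex a of the i-th K_t.
fanAdj : (t n : ℕ) → Maybe (Fin n × Fin t) → Maybe (Fin n × Fin t) → Set
fanAdj t n nothing nothing = ⊥
fanAdj t n nothing (just _) = ⊤
fanAdj t n (just _) nothing = ⊤
fanAdj t n (just (i , a)) (just (j , b)) = i ≡ j × a ≢ b

fan : ℕ → ℕ → Graph
fan t n = record { V = Maybe (Fin n × Fin t) ; Adj = fanAdj t n }

module Submission where

-- On N = max(s,n) + (t−1)n + s vertices, grow a red matching greedily: add a red edge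
-- between unmatched vertices, or replace a matching edge uv by ux, vy for distinct unmatched x, y.
-- Each step adds an edge, so either s red edges appear or the process stops with k < s edges. Then
-- the unmatched set I (of size N − 2k) is a blue clique, and every matching edge has an endpoint,
-- its hub, that is blue to all of I but at most one vertex, its exception. A blue F_{t,n} is
-- centred at a vertex c of I that is not the exception of any hub it uses; min(k,n) of its cliques
-- are a hub with t−1 vertices of I avoiding the hub's exception, the others lie inside I, and |I|
-- is just large enough for this.
--
-- Lower bound, on N − 1 vertices. If n ≤ s, colour red exactly the edges inside the first 2s−1
-- vertices: a red matching has at most s−1 edges, and a blue clique meets those vertices at most
-- once, so a blue F_{t,n} would need (t−1)n + 1 of the (t−1)n remaining vertices. If s < n, colour
-- red exactly the edges meeting the first s−1 vertices: every red edge meets them, and a blue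
-- F_{t,n} avoids them but has nt + 1 > N − s vertices.

open import Defs
open import Data.Bool using (Bool; true; false; not; _∧_; _∨_; T)
open import Data.Bool.Properties using (not-¬; ∧-comm; ∨-comm)
open import Data.Empty using (⊥-elim)
open import Data.Fin using (Fin; zero; suc; toℕ; fromℕ<; combine; remQuot)
import Data.Fin.Properties as Finₚ
open import Data.List as List using (List; []; _∷_; _++_; [_]; length; map; take; drop; allFin)
import Data.List.Properties as Listₚ
open import Data.List.Membership.Propositional using (_∈_; _∉_; find; lose)
import Data.List.Membership.Propositional.Properties as ∈ₚ
import Data.List.Membership.DecPropositional as DecMembership
open import Data.List.Relation.Binary.Permutation.Propositional
  using (_↭_; ↭-refl; ↭-sym; ↭-trans; prep; swap; ↭⇒↭ₛ; module PermutationReasoning)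
import Data.List.Relation.Binary.Permutation.Propositional.Properties as ↭ₚ
import Data.List.Relation.Binary.Permutation.Setoid.Properties as Setoid↭ₚ
open import Data.List.Relation.Binary.Subset.Propositional using (_⊆_)
open import Data.List.Relation.Unary.All as All using (All; []; _∷_)
import Data.List.Relation.Unary.All.Properties as Allₚ
open import Data.List.Relation.Unary.AllPairs using ([]; _∷_)
open import Data.List.Relation.Unary.Any using (Any; here; there; any?)
open import Data.List.Relation.Unary.Unique.Propositional using (Unique)
import Data.List.Relation.Unary.Unique.Propositional.Properties as Uniqueₚ
open import Data.Maybe using (just; nothing)
open import Data.Maybe.Properties using (just-injective)
open import Data.Nat using (ℕ; zero; suc; _≤_; _<_; _+_; _*_; _∸_; _⊔_; z≤n; s≤s; z<s; _≤?_; _<?_)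
open import Data.Nat.Properties
open import Data.Nat.Tactic.RingSolver using (solve-∀)
open import Data.Product using (Σ; ∃; ∃₂; _×_; _,_; proj₁; proj₂; uncurry; map₁; map₂)
open import Data.Sum using (_⊎_; inj₁; inj₂)
import Data.Sum as Sum
open import Data.Unit using (tt)
open import Data.Vec using (Vec; []; _∷_; toList; concat; lookup)
import Data.Vec.Properties as Vecₚ
import Data.Vec.Membership.Propositional.Properties as Vec∈ₚ
import Data.Vec.Relation.Unary.All.Properties as VecAllₚ
open import Data.Vec.Relation.Unary.AllPairs using ([]; _∷_)
import Data.Vec.Relation.Unary.Unique.Propositional as VecUnique
import Data.Vec.Relation.Unary.Unique.Propositional.Properties as VecUniqueₚ
open import Function using (_∘_; case_of_)
open import Function.Bundles using (_↔_; Inverse; Injection)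
open import Function.Definitions using (Injective)
open import Function.Properties.Inverse using (Inverse⇒Injection)
open import Relation.Binary.Definitions using (DecidableEquality)
open import Relation.Binary.PropositionalEquality
  using (_≡_; _≢_; refl; trans; cong; cong₂; subst; module ≡-Reasoning)
import Relation.Binary.PropositionalEquality as ≡
open import Relation.Nullary using (¬_; Dec; yes; no)
open import Relation.Nullary.Decidable using (¬?; _×-dec_; decidable-stable; ⌊_⌋; toWitness; fromWitness)

module _ {A : Set} where

  Unique-resp-↭ : ∀ {xs ys : List A} → xs ↭ ys → Unique xs → Unique ys
  Unique-resp-↭ p = Setoid↭ₚ.Unique-resp-↭ (≡.setoid A) (↭⇒↭ₛ p)

  Unique-++⁻ˡ : ∀ xs {ys : List A} → Unique (xs ++ ys) → Unique xs
  Unique-++⁻ˡ []       _          = []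
  Unique-++⁻ˡ (_ ∷ xs) (x∉ ∷ xs!) = Allₚ.++⁻ˡ xs x∉ ∷ Unique-++⁻ˡ xs xs!

  Unique-++⁻ʳ : ∀ xs {ys : List A} → Unique (xs ++ ys) → Unique ys
  Unique-++⁻ʳ []       ys!       = ys!
  Unique-++⁻ʳ (_ ∷ xs) (_ ∷ xs!) = Unique-++⁻ʳ xs xs!

  Unique-toList⁻ : ∀ {n} {xs : Vec A n} → Unique (toList xs) → VecUnique.Unique xs
  Unique-toList⁻ {xs = []}    []         = []
  Unique-toList⁻ {xs = _ ∷ _} (x∉ ∷ xs!) = VecAllₚ.toList⁻ x∉ ∷ Unique-toList⁻ xs!

  lookup-∈-toList : ∀ {n} (xs : Vec A n) i → lookup xs i ∈ toList xs
  lookup-∈-toList xs i = Vec∈ₚ.∈-toList⁺ (Vec∈ₚ.∈-lookup i xs)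

  ∈⇒↭∷ : ∀ {x : A} {xs} → x ∈ xs → ∃ λ ys → xs ↭ x ∷ ys
  ∈⇒↭∷ {x} x∈xs with ys , zs , refl ← ∈ₚ.∈-∃++ x∈xs = ys ++ zs , ↭ₚ.shift x ys zs

  ↭++⇒⊆ˡ : ∀ {R xs ys : List A} → R ↭ xs ++ ys → xs ⊆ R
  ↭++⇒⊆ˡ R↭ = ↭ₚ.∈-resp-↭ (↭-sym R↭) ∘ ∈ₚ.∈-++⁺ˡ

  ↭++⇒⊆ʳ : ∀ {R} xs {ys : List A} → R ↭ xs ++ ys → ys ⊆ R
  ↭++⇒⊆ʳ xs R↭ = ↭ₚ.∈-resp-↭ (↭-sym R↭) ∘ ∈ₚ.∈-++⁺ʳ xs

  ↭++⇒Uniqueʳ : ∀ {R} xs {ys : List A} → Unique R → R ↭ xs ++ ys → Unique ys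
  ↭++⇒Uniqueʳ xs R! R↭ = Unique-++⁻ʳ xs (Unique-resp-↭ R↭ R!)

  ⊆-∷⁻ : ∀ {x : A} {xs ys} → x ∉ xs → xs ⊆ x ∷ ys → xs ⊆ ys
  ⊆-∷⁻ x∉xs xs⊆ z∈xs with xs⊆ z∈xs
  ... | here refl  = ⊥-elim (x∉xs z∈xs)
  ... | there z∈ys = z∈ys

  Unique⇒length≤ : ∀ {xs ys : List A} → Unique xs → xs ⊆ ys → length xs ≤ length ys
  Unique⇒length≤ {[]}     _                  _     = z≤n
  Unique⇒length≤ {x ∷ xs} x∷xs!@(_ ∷ xs!) xs⊆ys with ys′ , ys↭ ← ∈⇒↭∷ (xs⊆ys (here refl)) =
    ≤-trans (s≤s (Unique⇒length≤ xs! (⊆-∷⁻ x∉xs (↭ₚ.∈-resp-↭ ys↭ ∘ xs⊆ys ∘ there))))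
            (≤-reflexive (≡.sym (↭ₚ.↭-length ys↭)))
    where
    x∉xs : x ∉ xs
    x∉xs = Uniqueₚ.Unique[x∷xs]⇒x∉xs x∷xs!

  DistinctPair : (A → A → Set) → List A → Set
  DistinctPair P xs = Any (λ x → Any (λ y → x ≢ y × P x y) xs) xs

  DistinctPair⇒↭ : ∀ {P xs} → DistinctPair P xs → ∃₂ λ x y → P x y × ∃ λ zs → xs ↭ x ∷ y ∷ zs
  DistinctPair⇒↭ pair with x , x∈xs , inner ← find pair with y , y∈xs , x≢y , pxy ← find inner
    with ys , xs↭ ← ∈⇒↭∷ x∈xs with ↭ₚ.∈-resp-↭ xs↭ y∈xs
  ... | here y≡x   = ⊥-elim (x≢y (≡.sym y≡x))
  ... | there y∈ys with zs , ys↭ ← ∈⇒↭∷ y∈ys = x , y , pxy , zs , ↭-trans xs↭ (prep x ys↭)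

  ¬DistinctPair⇒¬ : ∀ {P xs x y} → ¬ DistinctPair P xs → x ∈ xs → y ∈ xs → x ≢ y → ¬ P x y
  ¬DistinctPair⇒¬ ¬pair x∈xs y∈xs x≢y pxy = ¬pair (lose x∈xs (lose y∈xs (x≢y , pxy)))

  pick : ∀ k (R : List A) → k ≤ length R → Σ (Vec A k) λ S → ∃ λ R′ → R ↭ toList S ++ R′
  pick zero    R       _         = [] , R , ↭-refl
  pick (suc k) (x ∷ R) (s≤s k≤R) with S , R′ , R↭ ← pick k R k≤R = x ∷ S , R′ , prep x R↭

  pick-length : ∀ {k} {R R′ : List A} (S : Vec A k) → R ↭ toList S ++ R′ → length R ≡ k + length R′
  pick-length {R = R} {R′} S R↭ = begin
    length R                      ≡⟨ ↭ₚ.↭-length R↭ ⟩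
    length (toList S ++ R′)       ≡⟨ Listₚ.length-++ (toList S) ⟩
    length (toList S) + length R′ ≡⟨ cong (_+ length R′) (Vecₚ.length-toList S) ⟩
    _ + length R′                 ∎
    where open ≡-Reasoning

  module _ (_≟_ : DecidableEquality A) where
    open DecMembership _≟_ using (_∈?_)

    distinctPair? : ∀ {P} → (∀ x y → Dec (P x y)) → ∀ xs → Dec (DistinctPair P xs)
    distinctPair? P? xs = any? (λ x → any? (λ y → ¬? (x ≟ y) ×-dec P? x y) xs) xs

    length<⇒∃∉ : ∀ {xs ys : List A} → Unique xs → length ys < length xs → ∃ λ x → x ∈ xs × x ∉ ys
    length<⇒∃∉ {xs} {ys} xs! ys<xs with any? (λ x → ¬? (x ∈? ys)) xs
    ... | yes outside = find outside
    ... | no ¬outside = ⊥-elim (<⇒≱ ys<xs (Unique⇒length≤ xs! xs⊆ys))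
      where
      xs⊆ys : xs ⊆ ys
      xs⊆ys {x} x∈xs = decidable-stable (x ∈? ys) (¬outside ∘ lose x∈xs)

    pickAvoiding : ∀ k w (R : List A) → Unique R → suc k ≤ length R →
                   Σ (Vec A k) λ S → ∃ λ R′ → R ↭ toList S ++ R′ × w ∉ toList S
    pickAvoiding zero    w R       _              _         = [] , R , ↭-refl , λ ()
    pickAvoiding (suc k) w (x ∷ R) x∷R!@(_ ∷ R!) (s≤s k<R) with x ≟ w
    ... | yes refl with S , R′ , R↭ ← pick (suc k) R k<R =
      S , x ∷ R′ , ↭-trans (prep x R↭) (↭-sym (↭ₚ.shift x (toList S) R′)) ,
      Uniqueₚ.Unique[x∷xs]⇒x∉xs x∷R! ∘ ↭++⇒⊆ˡ R↭
    ... | no x≢w with S , R′ , R↭ , w∉S ← pickAvoiding k w R R! k<R =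
      x ∷ S , R′ , prep x R↭ , λ { (here w≡x) → x≢w (≡.sym w≡x) ; (there w∈S) → w∉S w∈S }

map-take++drop : ∀ {A B : Set} (f : A → B) n xs → map f xs ≡ map f (take n xs) ++ map f (drop n xs)
map-take++drop f n xs =
  trans (cong (map f) (≡.sym (Listₚ.take++drop≡id n xs))) (Listₚ.map-++ f (take n xs) (drop n xs))

length-map-take≤ : ∀ {A B : Set} (f : A → B) n xs → length (map f (take n xs)) ≤ n
length-map-take≤ f n xs =
  ≤-trans (≤-reflexive (trans (Listₚ.length-map f (take n xs)) (Listₚ.length-take n xs))) (m⊓n≤m n _)

↭allFin⇒Unique : ∀ {N} {xs : List (Fin N)} → xs ↭ allFin N → Unique xs
↭allFin⇒Unique {N} xs↭ = Unique-resp-↭ (↭-sym xs↭) (Uniqueₚ.allFin⁺ N)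

-- Matchings as lists of pairs

module _ {A : Set} where

  endpoints : List (A × A) → List A
  endpoints []            = []
  endpoints ((u , v) ∷ M) = u ∷ v ∷ endpoints M

  endpoints-++ : ∀ M M′ → endpoints (M ++ M′) ≡ endpoints M ++ endpoints M′
  endpoints-++ []            M′ = refl
  endpoints-++ ((u , v) ∷ M) M′ = cong (λ e → u ∷ v ∷ e) (endpoints-++ M M′)

  length-endpoints : ∀ M → length (endpoints M) ≡ length M + length M
  length-endpoints []      = refl
  length-endpoints (_ ∷ M) = cong suc (trans (cong suc (length-endpoints M)) (≡.sym (+-suc _ _)))

  endpoint : Bool → A × A → A
  endpoint false = proj₁
  endpoint true  = proj₂

  endpoint-injective : ∀ {u v : A} → u ≢ v → ∀ b b′ →
                       endpoint b (u , v) ≡ endpoint b′ (u , v) → b ≡ b′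
  endpoint-injective u≢v false false _ = refl
  endpoint-injective u≢v true  true  _ = refl
  endpoint-injective u≢v false true  e = ⊥-elim (u≢v e)
  endpoint-injective u≢v true  false e = ⊥-elim (u≢v (≡.sym e))

  endpoint-∉ : ∀ {u v : A} {E} → All (u ≢_) E → All (v ≢_) E → ∀ b → endpoint b (u , v) ∉ E
  endpoint-∉ u∉E v∉E false u∈E = All.lookup u∉E u∈E refl
  endpoint-∉ u∉E v∉E true  v∈E = All.lookup v∉E v∈E refl

  matchingEmbedding : (M : List (A × A)) → Fin (length M) × Bool → A
  matchingEmbedding M (i , b) = endpoint b (List.lookup M i)

  matchingEmbedding-∈ : ∀ M p → matchingEmbedding M p ∈ endpoints M
  matchingEmbedding-∈ (_ ∷ M) (zero  , false) = here refl
  matchingEmbedding-∈ (_ ∷ M) (zero  , true)  = there (here refl)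
  matchingEmbedding-∈ (_ ∷ M) (suc i , b)     = there (there (matchingEmbedding-∈ M (i , b)))

  matchingEmbedding-injective : ∀ M → Unique (endpoints M) → Injective _≡_ _≡_ (matchingEmbedding M)
  matchingEmbedding-injective (_ ∷ M) ((u≢v ∷ _) ∷ _ ∷ _) {zero , b} {zero , b′} e =
    cong (zero ,_) (endpoint-injective u≢v b b′ e)
  matchingEmbedding-injective (_ ∷ M) ((_ ∷ u∉E) ∷ v∉E ∷ _) {zero , b} {suc j , b′} e =
    ⊥-elim (endpoint-∉ u∉E v∉E b (subst (_∈ endpoints M) (≡.sym e) (matchingEmbedding-∈ M (j , b′))))
  matchingEmbedding-injective (_ ∷ M) ((_ ∷ u∉E) ∷ v∉E ∷ _) {suc i , b} {zero , b′} e =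
    ⊥-elim (endpoint-∉ u∉E v∉E b′ (subst (_∈ endpoints M) e (matchingEmbedding-∈ M (i , b))))
  matchingEmbedding-injective (_ ∷ M) (_ ∷ _ ∷ E!) {suc i , b} {suc j , b′} e =
    cong (map₁ suc) (matchingEmbedding-injective M E! e)

module _ {A : Set} where
  open import Algebra.Solver.CommutativeMonoid (↭ₚ.++-commutativeMonoid {A = A}) using (solve; _⊕_; _⊜_)

  extend-↭ : ∀ M {I I′} {x y : A} → I ↭ x ∷ y ∷ I′ →
             endpoints M ++ I ↭ endpoints ((x , y) ∷ M) ++ I′
  extend-↭ M {I′ = I′} {x} {y} I↭ = ↭-trans (↭ₚ.++⁺ˡ (endpoints M) I↭)
    (solve 4 (λ E X Y J → E ⊕ (X ⊕ (Y ⊕ J)) ⊜ X ⊕ (Y ⊕ (E ⊕ J))) ↭-refl (endpoints M) [ x ] [ y ] I′)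

  augment-↭ : ∀ L L′ {u v x y : A} {I I′} → I ↭ x ∷ y ∷ I′ →
              endpoints (L ++ (u , v) ∷ L′) ++ I ↭ endpoints ((u , x) ∷ (v , y) ∷ L ++ L′) ++ I′
  augment-↭ L L′ {u} {v} {x} {y} {I} {I′} I↭ = begin
    endpoints (L ++ (u , v) ∷ L′) ++ I            ≡⟨ cong (_++ I) (endpoints-++ L ((u , v) ∷ L′)) ⟩
    (E ++ u ∷ v ∷ E′) ++ I                        ↭⟨ ↭ₚ.++⁺ˡ (E ++ u ∷ v ∷ E′) I↭ ⟩
    (E ++ u ∷ v ∷ E′) ++ x ∷ y ∷ I′               ↭⟨ solve 7 (λ E E′ U V X Y J →
                                                        (E ⊕ (U ⊕ (V ⊕ E′))) ⊕ (X ⊕ (Y ⊕ J)) ⊜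
                                                        U ⊕ (X ⊕ (V ⊕ (Y ⊕ ((E ⊕ E′) ⊕ J)))))
                                                      ↭-refl E E′ [ u ] [ v ] [ x ] [ y ] I′ ⟩
    u ∷ x ∷ v ∷ y ∷ (E ++ E′) ++ I′               ≡⟨ cong (λ e → u ∷ x ∷ v ∷ y ∷ e ++ I′)
                                                           (endpoints-++ L L′) ⟨
    endpoints ((u , x) ∷ (v , y) ∷ L ++ L′) ++ I′ ∎
    where
    open PermutationReasoning
    E E′ : List A
    E  = endpoints L
    E′ = endpoints L′

  cons₂-↭ : ∀ {u v h o : A} {E H O} → u ∷ v ∷ [] ↭ h ∷ o ∷ [] → E ↭ H ++ O →
            u ∷ v ∷ E ↭ h ∷ H ++ o ∷ O
  cons₂-↭ {h = h} {o} {H = H} {O} uv↭ E↭ = ↭-trans (↭ₚ.++⁺ uv↭ E↭)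
    (solve 4 (λ X Y H O → X ⊕ (Y ⊕ (H ⊕ O)) ⊜ X ⊕ (H ⊕ (Y ⊕ O))) ↭-refl [ h ] [ o ] H O)

  addGroup-↭ : ∀ {k n} (g : Vec A k) (G : Vec (Vec A k) n) {P S R R₁ R′ X : List A} →
               toList g ≡ P ++ S → R ↭ S ++ R₁ → toList (concat G) ++ R′ ↭ X ++ R₁ →
               toList (concat (g ∷ G)) ++ R′ ↭ (P ++ X) ++ R
  addGroup-↭ g G {P} {S} {R} {R₁} {R′} {X} g≡ R↭ G↭ = begin
    toList (concat (g ∷ G)) ++ R′ ≡⟨ cong (_++ R′) (trans (Vecₚ.toList-++ g (concat G)) (cong (_++ C) g≡)) ⟩
    ((P ++ S) ++ C) ++ R′         ↭⟨ solve 4 (λ P S C R′ → ((P ⊕ S) ⊕ C) ⊕ R′ ⊜ (P ⊕ S) ⊕ (C ⊕ R′))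
                                         ↭-refl P S C R′ ⟩
    (P ++ S) ++ (C ++ R′)         ↭⟨ ↭ₚ.++⁺ˡ (P ++ S) G↭ ⟩
    (P ++ S) ++ (X ++ R₁)         ↭⟨ solve 4 (λ P S X R₁ → (P ⊕ S) ⊕ (X ⊕ R₁) ⊜ (P ⊕ X) ⊕ (S ⊕ R₁))
                                         ↭-refl P S X R₁ ⟩
    (P ++ X) ++ (S ++ R₁)         ↭⟨ ↭ₚ.++⁺ˡ (P ++ X) (↭-sym R↭) ⟩
    (P ++ X) ++ R                 ∎
    where
    open PermutationReasoning
    C : List A
    C = toList (concat G)

  regroup-↭ : ∀ {c : A} {E I L P Q O R₀ C R′} → E ++ I ↭ L → E ↭ (P ++ Q) ++ O → I ↭ c ∷ R₀ →
              C ++ R′ ↭ P ++ R₀ → L ↭ (c ∷ C) ++ (R′ ++ (Q ++ O))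
  regroup-↭ {c} {E} {I} {L} {P} {Q} {O} {R₀} {C} {R′} partition E↭ I↭ C↭ = begin
    L                           ↭⟨ partition ⟨
    E ++ I                      ↭⟨ ↭ₚ.++⁺ E↭ I↭ ⟩
    ((P ++ Q) ++ O) ++ c ∷ R₀   ↭⟨ solve 5 (λ X P Q O R₀ →
                                       ((P ⊕ Q) ⊕ O) ⊕ (X ⊕ R₀) ⊜ X ⊕ ((P ⊕ R₀) ⊕ (Q ⊕ O)))
                                     ↭-refl [ c ] P Q O R₀ ⟩
    c ∷ (P ++ R₀) ++ (Q ++ O)   ↭⟨ prep c (↭ₚ.++⁺ʳ (Q ++ O) C↭) ⟨
    c ∷ (C ++ R′) ++ (Q ++ O)   ↭⟨ solve 4 (λ X C R′ Y → X ⊕ ((C ⊕ R′) ⊕ Y) ⊜ (X ⊕ C) ⊕ (R′ ⊕ Y))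
                                     ↭-refl [ c ] C R′ (Q ++ O) ⟩
    (c ∷ C) ++ (R′ ++ (Q ++ O)) ∎
    where open PermutationReasoning

-- The upper bound

-- Vertices of I besides the centre that suffice to build n cliques of size t₁ + 1 from k hubs:
-- a hub takes t₁ vertices of I, and one more must be available so that its exception can be skipped.
demand : ℕ → ℕ → ℕ → ℕ
demand t₁ n       zero    = n * suc t₁
demand t₁ zero    (suc k) = 0
demand t₁ (suc n) (suc k) = (t₁ + demand t₁ n k) ⊔ suc t₁

n≤demand : ∀ a n k → n ≤ demand (suc a) n k
n≤demand a n       zero    = m≤m*n n (suc (suc a))
n≤demand a zero    (suc k) = z≤n
n≤demand a (suc n) (suc k) =
  ≤-trans (s≤s (≤-trans (n≤demand a n k) (m≤n+m _ a))) (m≤m⊔n (suc a + demand (suc a) n k) (suc (suc a)))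

demand-bound : ∀ t₁ n k → demand t₁ n k + k ≤ t₁ * n + (n ⊔ suc k)
demand-bound t₁ n zero = begin
  n * suc t₁ + 0   ≡⟨ reorder t₁ n ⟩
  t₁ * n + n       ≤⟨ +-monoʳ-≤ (t₁ * n) (m≤m⊔n n 1) ⟩
  t₁ * n + (n ⊔ 1) ∎
  where
  open ≤-Reasoning
  reorder : ∀ t₁ n → n * suc t₁ + 0 ≡ t₁ * n + n
  reorder = solve-∀
demand-bound t₁ zero (suc k) = ≤-trans (n≤1+n _) (m≤n+m _ (t₁ * 0))
demand-bound t₁ (suc n) (suc k) = begin
  ((t₁ + d) ⊔ suc t₁) + suc k         ≡⟨ +-distribʳ-⊔ (suc k) (t₁ + d) (suc t₁) ⟩
  (t₁ + d + suc k) ⊔ (suc t₁ + suc k) ≤⟨ ⊔-lub hubBound spareBound ⟩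
  t₁ * suc n + suc (n ⊔ suc k)        ∎
  where
  open ≤-Reasoning
  d : ℕ
  d = demand t₁ n k
  reorder₁ : ∀ t d k → t + d + suc k ≡ suc (t + (d + k))
  reorder₁ = solve-∀
  reorder₂ : ∀ t n X → suc (t + (t * n + X)) ≡ t * suc n + suc X
  reorder₂ = solve-∀
  hubBound : t₁ + d + suc k ≤ t₁ * suc n + suc (n ⊔ suc k)
  hubBound = begin
    t₁ + d + suc k                    ≡⟨ reorder₁ t₁ d k ⟩
    suc (t₁ + (d + k))                ≤⟨ s≤s (+-monoʳ-≤ t₁ (demand-bound t₁ n k)) ⟩
    suc (t₁ + (t₁ * n + (n ⊔ suc k))) ≡⟨ reorder₂ t₁ n (n ⊔ suc k) ⟩
    t₁ * suc n + suc (n ⊔ suc k)      ∎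
  spareBound : suc t₁ + suc k ≤ t₁ * suc n + suc (n ⊔ suc k)
  spareBound = begin
    suc t₁ + suc k               ≡⟨ +-suc t₁ (suc k) ⟨
    t₁ + suc (suc k)             ≤⟨ +-mono-≤ (m≤m*n t₁ (suc n)) (s≤s (m≤n⊔m n (suc k))) ⟩
    t₁ * suc n + suc (n ⊔ suc k) ∎

demand-fits : ∀ t₁ n {k s m} → k < s → k + k + m ≡ (s ⊔ n) + t₁ * n + s → demand t₁ n k < m
demand-fits t₁ n {k} {s} {m} k<s size = +-cancelˡ-≤ (k + k) _ _ (begin
  k + k + suc d            ≡⟨ reorder k d ⟩
  (d + k) + suc k          ≤⟨ +-mono-≤ (demand-bound t₁ n k) k<s ⟩
  t₁ * n + (n ⊔ suc k) + s ≤⟨ +-monoˡ-≤ s (+-monoʳ-≤ (t₁ * n) n⊔1+k≤s⊔n) ⟩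
  t₁ * n + (s ⊔ n) + s     ≡⟨ cong (_+ s) (+-comm (t₁ * n) (s ⊔ n)) ⟩
  (s ⊔ n) + t₁ * n + s     ≡⟨ size ⟨
  k + k + m                ∎)
  where
  open ≤-Reasoning
  d : ℕ
  d = demand t₁ n k
  n⊔1+k≤s⊔n : n ⊔ suc k ≤ s ⊔ n
  n⊔1+k≤s⊔n = ⊔-lub (m≤n⊔m s n) (≤-trans k<s (m≤m⊔n s n))
  reorder : ∀ k d → k + k + suc d ≡ (d + k) + suc k
  reorder = solve-∀

+-suc⁻ : ∀ {m d s} → m + suc d ≡ s → suc m + d ≡ s
+-suc⁻ {m} {d} m+1+d≡s = trans (≡.sym (+-suc m d)) m+1+d≡s

_≟ᶜ_ : DecidableEquality Colour
red  ≟ᶜ red  = yes refl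
red  ≟ᶜ blue = no λ ()
blue ≟ᶜ red  = no λ ()
blue ≟ᶜ blue = yes refl

≢red⇒≡blue : ∀ {k} → k ≢ red → k ≡ blue
≢red⇒≡blue {red}  k≢red = ⊥-elim (k≢red refl)
≢red⇒≡blue {blue} _     = refl

module _ {N : ℕ} (κ : Colouring N) where

  Red Blue : Fin N → Fin N → Set
  Red  x y = col κ x y ≡ red
  Blue x y = col κ x y ≡ blue

  BlueClique : List (Fin N) → Set
  BlueClique K = ∀ {x y} → x ∈ K → y ∈ K → x ≢ y → Blue x y

  BlueClique-⊆ : ∀ {K L} → K ⊆ L → BlueClique L → BlueClique K
  BlueClique-⊆ K⊆L L-blue x∈K y∈K = L-blue (K⊆L x∈K) (K⊆L y∈K)

  BlueClique-∷ : ∀ {x K} → BlueClique K → (∀ {y} → y ∈ K → Blue x y) → BlueClique (x ∷ K)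
  BlueClique-∷ K-blue x-blue (here refl) (here refl) x≢x = ⊥-elim (x≢x refl)
  BlueClique-∷ K-blue x-blue (here refl) (there y∈K) _   = x-blue y∈K
  BlueClique-∷ K-blue x-blue (there y∈K) (here refl) _   = trans (sym κ _ _) (x-blue y∈K)
  BlueClique-∷ K-blue x-blue (there x∈K) (there y∈K) x≢y = K-blue x∈K y∈K x≢y

  redMatchingCopy : ∀ M → Unique (endpoints M) → All (uncurry Red) M → MonoCopy N κ red (matching (length M))
  redMatchingCopy M M! M-red = matchingEmbedding M , matchingEmbedding-injective M M! , red-edges
    where
    red-edges : ∀ p q → Adj (matching (length M)) p q → Red (matchingEmbedding M p) (matchingEmbedding M q)
    red-edges (i , false) (.i , false) (refl , f≢f) = ⊥-elim (f≢f refl)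
    red-edges (i , false) (.i , true)  (refl , _)   = All.lookup M-red (∈ₚ.∈-lookup i)
    red-edges (i , true)  (.i , false) (refl , _)   = trans (sym κ _ _) (All.lookup M-red (∈ₚ.∈-lookup i))
    red-edges (i , true)  (.i , true)  (refl , t≢t) = ⊥-elim (t≢t refl)

  fanCopy : ∀ {t n} (c : Fin N) (G : Vec (Vec (Fin N) t) n) → Unique (toList (c ∷ concat G)) →
            (∀ i → BlueClique (c ∷ toList (lookup G i))) → MonoCopy N κ blue (fan t n)
  fanCopy {t} {n} c G cG! G-blue = embed , embed-injective , blue-edges
    where
    index : V (fan t n) → Fin (suc (n * t))
    index nothing        = zero
    index (just (i , a)) = suc (combine i a)

    index-injective : Injective _≡_ _≡_ index
    index-injective {nothing}      {nothing}      _ = refl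
    index-injective {just (i , a)} {just (j , b)} e =
      cong just (uncurry (cong₂ _,_) (Finₚ.combine-injective i a j b (Finₚ.suc-injective e)))

    embed : V (fan t n) → Fin N
    embed = lookup (c ∷ concat G) ∘ index

    embed-injective : Injective _≡_ _≡_ embed
    embed-injective e = index-injective (VecUniqueₚ.lookup-injective (Unique-toList⁻ cG!) _ _ e)

    embed-≢ : ∀ {p q} → p ≢ q → embed p ≢ embed q
    embed-≢ p≢q = p≢q ∘ embed-injective

    leaf-∈ : ∀ i a → embed (just (i , a)) ∈ c ∷ toList (lookup G i)
    leaf-∈ i a = there (subst (_∈ toList (lookup G i)) (≡.sym (Vecₚ.lookup-concat G i a))
                                (lookup-∈-toList (lookup G i) a))

    blue-edges : ∀ p q → fanAdj t n p q → Blue (embed p) (embed q)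
    blue-edges nothing        (just (i , a))  _ =
      G-blue i (here refl) (leaf-∈ i a) (embed-≢ {nothing} {just (i , a)} λ ())
    blue-edges (just (i , a)) nothing         _ =
      G-blue i (leaf-∈ i a) (here refl) (embed-≢ {just (i , a)} {nothing} λ ())
    blue-edges (just (i , a)) (just (.i , b)) (refl , a≢b) =
      G-blue i (leaf-∈ i a) (leaf-∈ i b) (embed-≢ (a≢b ∘ cong proj₂ ∘ just-injective))

  Augmenting : List (Fin N) → Fin N × Fin N → Set
  Augmenting I (u , v) = DistinctPair (λ x y → Red u x × Red v y) I

  augmenting? : ∀ I e → Dec (Augmenting I e)
  augmenting? I (u , v) = distinctPair? Finₚ._≟_ (λ x y → (col κ u x ≟ᶜ red) ×-dec (col κ v y ≟ᶜ red)) I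

  record Stuck (s : ℕ) : Set where
    field
      M         : List (Fin N × Fin N)
      I         : List (Fin N)
      partition : endpoints M ++ I ↭ allFin N
      I-blue    : BlueClique I
      maximal   : All (λ e → ¬ Augmenting I e) M
      small     : length M < s

    I-unique : Unique I
    I-unique = Unique-++⁻ʳ (endpoints M) (↭allFin⇒Unique partition)

    size : length M + length M + length I ≡ N
    size = begin
      length M + length M + length I ≡⟨ cong (_+ length I) (length-endpoints M) ⟨
      length (endpoints M) + length I ≡⟨ Listₚ.length-++ (endpoints M) ⟨
      length (endpoints M ++ I)       ≡⟨ ↭ₚ.↭-length partition ⟩
      length (allFin N)               ≡⟨ Listₚ.length-tabulate {n = N} (λ i → i) ⟩
      N                               ∎
      where open ≡-Reasoning

  greedy : ∀ {s} d M I → length M + d ≡ s → endpoints M ++ I ↭ allFin N → All (uncurry Red) M →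
           MonoCopy N κ red (matching s) ⊎ Stuck s
  greedy zero M I M+0≡s partition M-red =
    inj₁ (subst (MonoCopy N κ red ∘ matching) (trans (≡.sym (+-identityʳ _)) M+0≡s)
      (redMatchingCopy M (Unique-++⁻ˡ (endpoints M) (↭allFin⇒Unique partition)) M-red))
  greedy {s} (suc d) M I M+d≡s partition M-red with distinctPair? Finₚ._≟_ (λ x y → col κ x y ≟ᶜ red) I
  ... | yes redPair with x , y , xy-red , I′ , I↭ ← DistinctPair⇒↭ redPair =
    greedy d ((x , y) ∷ M) I′ (+-suc⁻ M+d≡s)
      (↭-trans (↭-sym (extend-↭ M I↭)) partition) (xy-red ∷ M-red)
  ... | no ¬redPair with any? (augmenting? I) M
  ...   | yes augmentable with (u , v) , uv∈M , augmenting ← find augmentable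
          with L , L′ , refl ← ∈ₚ.∈-∃++ uv∈M
          with x , y , (ux-red , vy-red) , I′ , I↭ ← DistinctPair⇒↭ augmenting =
    greedy d ((u , x) ∷ (v , y) ∷ L ++ L′) I′
      (subst (λ k → suc k + d ≡ s) (Listₚ.length-++-sucʳ L (u , v) L′) (+-suc⁻ M+d≡s))
      (↭-trans (↭-sym (augment-↭ L L′ I↭)) partition)
      (ux-red ∷ vy-red ∷ Allₚ.++⁺ (Allₚ.++⁻ˡ L M-red) (All.tail (Allₚ.++⁻ʳ L M-red)))
  ...   | no ¬augmentable = inj₂ record
    { M         = M
    ; I         = I
    ; partition = partition
    ; I-blue    = λ x∈I y∈I x≢y → ≢red⇒≡blue (¬DistinctPair⇒¬ ¬redPair x∈I y∈I x≢y)
    ; maximal   = Allₚ.¬Any⇒All¬ M ¬augmentable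
    ; small     = subst (length M <_) M+d≡s (m<m+n (length M) z<s) }

  record Hub (I : List (Fin N)) : Set where
    field
      hub         : Fin N
      exception   : Fin N
      almost-blue : ∀ {y} → y ∈ I → y ≢ exception → Blue hub y
  open Hub

  -- If u has a red neighbour x in I, then v is blue to I − x, as uv cannot be augmented;
  -- otherwise u is blue to all of I and its exception is immaterial.
  hubOf : ∀ {I u v} → ¬ Augmenting I (u , v) → Σ (Hub I) λ h → ∃ λ o → u ∷ v ∷ [] ↭ hub h ∷ o ∷ []
  hubOf {I} {u} {v} ¬augmenting with any? (λ x → col κ u x ≟ᶜ red) I
  ... | yes u-red with x , x∈I , ux-red ← find u-red =
    record { hub = v ; exception = x ; almost-blue = λ y∈I y≢x →
               ≢red⇒≡blue (¬DistinctPair⇒¬ ¬augmenting x∈I y∈I (y≢x ∘ ≡.sym) ∘ (ux-red ,_)) } ,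
    u , swap u v ↭-refl
  ... | no ¬u-red =
    record { hub = u ; exception = u ; almost-blue = λ y∈I _ → ≢red⇒≡blue (¬u-red ∘ lose y∈I) } ,
    v , ↭-refl

  hubs : ∀ {I} M → All (λ e → ¬ Augmenting I e) M →
         Σ (List (Hub I)) λ H → ∃ λ O → endpoints M ↭ map hub H ++ O × length H ≡ length M
  hubs []            []                      = [] , [] , ↭-refl , refl
  hubs ((u , v) ∷ M) (¬augmenting ∷ maximal) =
    let h , o , uv↭              = hubOf ¬augmenting
        H , O , M↭ , |H|≡|M| = hubs M maximal
    in h ∷ H , o ∷ O , cons₂-↭ uv↭ M↭ , cong suc |H|≡|M|

  module _ {I : List (Fin N)} (I-blue : BlueClique I) {c : Fin N} (c∈I : c ∈ I) (t₁ : ℕ) where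

    pureGroup-blue : ∀ {S} → S ⊆ I → BlueClique (c ∷ S)
    pureGroup-blue S⊆I = BlueClique-⊆ (λ { (here refl) → c∈I ; (there y∈S) → S⊆I y∈S }) I-blue

    hubGroup-blue : ∀ (h : Hub I) {S} → c ≢ exception h → S ⊆ I → exception h ∉ S →
                    BlueClique (c ∷ hub h ∷ S)
    hubGroup-blue h c≢w S⊆I w∉S = BlueClique-⊆ (↭ₚ.∈-resp-↭ (swap c (hub h) ↭-refl))
                                    (BlueClique-∷ (pureGroup-blue S⊆I) hub-blue)
      where
      hub-blue : ∀ {y} → y ∈ c ∷ _ → Blue (hub h) y
      hub-blue (here refl) = almost-blue h c∈I c≢w
      hub-blue (there y∈S) = almost-blue h (S⊆I y∈S) (λ y≡w → w∉S (subst (_∈ _) y≡w y∈S))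

    Groups : ℕ → List (Fin N) → List (Fin N) → Set
    Groups n X R = Σ (Vec (Vec (Fin N) (suc t₁)) n) λ G → ∃ λ R′ →
                     toList (concat G) ++ R′ ↭ X ++ R × (∀ i → BlueClique (c ∷ toList (lookup G i)))

    pureGroups : ∀ n R → Unique R → R ⊆ I → n * suc t₁ ≤ length R → Groups n [] R
    pureGroups zero    R _  _   _   = [] , R , ↭-refl , λ ()
    pureGroups (suc n) R R! R⊆I n≤R with S , R₁ , R↭ ← pick (suc t₁) R (≤-trans (m≤m+n _ _) n≤R) =
      let G , R′ , G↭ , G-blue = pureGroups n R₁ (↭++⇒Uniqueʳ (toList S) R! R↭) (R⊆I ∘ ↭++⇒⊆ʳ (toList S) R↭)
                                   (+-cancelˡ-≤ (suc t₁) _ _ (subst (_ ≤_) (pick-length S R↭) n≤R))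
      in S ∷ G , R′ , addGroup-↭ S G {P = []} refl R↭ G↭ ,
         λ { zero    → pureGroup-blue (R⊆I ∘ ↭++⇒⊆ˡ R↭)
           ; (suc i) → G-blue i }

    groups : ∀ n (H : List (Hub I)) R → Unique R → R ⊆ I → All (λ h → c ≢ exception h) (take n H) →
             demand t₁ n (length H) ≤ length R → Groups n (map hub (take n H)) R
    groups zero    H       R _  _   _             _   = [] , R , ↭-refl , λ ()
    groups (suc n) []      R R! R⊆I _             d≤R = pureGroups (suc n) R R! R⊆I d≤R
    groups (suc n) (h ∷ H) R R! R⊆I (c≢w ∷ c≢W) d≤R
      with S , R₁ , R↭ , w∉S ← pickAvoiding Finₚ._≟_ t₁ (exception h) R R! (≤-trans (m≤n⊔m _ _) d≤R)
      = 
      let t₁+d≤R = subst (t₁ + demand t₁ n (length H) ≤_) (pick-length S R↭) (≤-trans (m≤m⊔n _ _) d≤R)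
          G , R′ , G↭ , G-blue = groups n H R₁ (↭++⇒Uniqueʳ (toList S) R! R↭) (R⊆I ∘ ↭++⇒⊆ʳ (toList S) R↭)
                                   c≢W (+-cancelˡ-≤ t₁ _ _ t₁+d≤R)
      in (hub h ∷ S) ∷ G , R′ , addGroup-↭ (hub h ∷ S) G {P = [ hub h ]} refl R↭ G↭ ,
         λ { zero    → hubGroup-blue h c≢w (R⊆I ∘ ↭++⇒⊆ˡ R↭) w∉S
           ; (suc i) → G-blue i }

  stuck⇒fan : ∀ {s} a n → N ≡ (s ⊔ n) + suc a * n + s → Stuck s → MonoCopy N κ blue (fan (suc (suc a)) n)
  stuck⇒fan {s} a n N≡ stuck =
    let H , O , M↭ , |H|≡|M| = hubs M maximal
        d : ℕ
        d = demand (suc a) n (length H)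
        d<I : d < length I
        d<I = subst (λ k → demand (suc a) n k < length I) (≡.sym |H|≡|M|)
                (demand-fits (suc a) n small (trans size N≡))
        W : List (Fin N)
        W = map exception (take n H)
        W<I : length W < length I
        W<I = ≤-<-trans (length-map-take≤ exception n H) (≤-<-trans (n≤demand a n (length H)) d<I)
        c , c∈I , c∉W = length<⇒∃∉ Finₚ._≟_ I-unique W<I
        R₀ , I↭ = ∈⇒↭∷ c∈I
        G , R′ , G↭ , G-blue = groups I-blue c∈I (suc a) n H R₀ (↭++⇒Uniqueʳ [ c ] I-unique I↭)
                                 (↭++⇒⊆ʳ [ c ] I↭) (Allₚ.map⁻ (Allₚ.¬Any⇒All¬ W c∉W))
                                 (≤-pred (subst (d <_) (↭ₚ.↭-length I↭) d<I))
        M↭′ : endpoints M ↭ (map hub (take n H) ++ map hub (drop n H)) ++ O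
        M↭′ = subst (λ X → endpoints M ↭ X ++ O) (map-take++drop hub n H) M↭
        everything↭ : allFin N ↭ (c ∷ toList (concat G)) ++ (R′ ++ (map hub (drop n H) ++ O))
        everything↭ = regroup-↭ {C = toList (concat G)} {R′} partition M↭′ I↭ G↭
    in fanCopy c G (Unique-++⁻ˡ (toList (c ∷ concat G)) (↭allFin⇒Unique (↭-sym everything↭))) G-blue
    where open Stuck stuck

upperBound : ∀ s n a → Arrows ((s ⊔ n) + suc a * n + s) (matching s) (fan (suc (suc a)) n)
upperBound s n a κ with greedy κ s [] (allFin _) refl ↭-refl []
... | inj₁ redMatching = inj₁ redMatching
... | inj₂ stuck       = inj₂ (stuck⇒fan κ a n refl stuck)

-- The lower bound

injective-between⇒≤ : ∀ {K m} lo hi (f : Fin K → Fin m) → Injective _≡_ _≡_ f →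
                      (∀ x → lo ≤ toℕ (f x)) → (∀ x → toℕ (f x) < hi) → K ≤ hi ∸ lo
injective-between⇒≤ {K} lo hi f f-injective lo≤f f<hi = Finₚ.injective⇒≤ g-injective
  where
  g : Fin K → Fin (hi ∸ lo)
  g x = fromℕ< (∸-monoˡ-< (f<hi x) (lo≤f x))
  g-injective : Injective _≡_ _≡_ g
  g-injective {x} {y} gx≡gy = f-injective (Finₚ.toℕ-injective (∸-cancelʳ-≡ (lo≤f x) (lo≤f y) (begin
    toℕ (f x) ∸ lo ≡⟨ Finₚ.toℕ-fromℕ< _ ⟨
    toℕ (g x)      ≡⟨ cong toℕ gx≡gy ⟩
    toℕ (g y)      ≡⟨ Finₚ.toℕ-fromℕ< _ ⟩
    toℕ (f y) ∸ lo ∎)))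
    where open ≡-Reasoning

↔-injective : ∀ {A B : Set} (e : A ↔ B) → Injective _≡_ _≡_ (Inverse.to e)
↔-injective e = Injection.injective (Inverse⇒Injection e)

enumerateMatching : ∀ s → Fin (s * 2) → V (matching s)
enumerateMatching s = map₂ (Inverse.to Finₚ.2↔Bool) ∘ remQuot 2

enumerateMatching-injective : ∀ s → Injective _≡_ _≡_ (enumerateMatching s)
enumerateMatching-injective s e =
  ↔-injective (Finₚ.*↔× {s} {2}) (cong₂ _,_ (cong proj₁ e) (↔-injective Finₚ.2↔Bool (cong proj₂ e)))

enumerateFan : ∀ t n → Fin (suc (n * t)) → V (fan t n)
enumerateFan t n zero    = nothing
enumerateFan t n (suc x) = just (remQuot t x)

enumerateFan-injective : ∀ t n → Injective _≡_ _≡_ (enumerateFan t n)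
enumerateFan-injective t n {zero}  {zero}  _ = refl
enumerateFan-injective t n {suc x} {suc y} e = cong suc (↔-injective (Finₚ.*↔× {n} {t}) (just-injective e))

redIf : Bool → Colour
redIf true  = red
redIf false = blue

redIf-∧-red : ∀ p q → redIf (p ∧ q) ≡ red → T p
redIf-∧-red true _ _ = _

redIf-∧-blue : ∀ p q → redIf (p ∧ q) ≡ blue → T p → ¬ T q
redIf-∧-blue true true () _ _

redIf-∨-red : ∀ p q → redIf (p ∨ q) ≡ red → T p ⊎ T q
redIf-∨-red true  _    _ = inj₁ _
redIf-∨-red false true _ = inj₂ _

redIf-∨-blue : ∀ p q → redIf (p ∨ q) ≡ blue → ¬ T p
redIf-∨-blue true _ () _

module _ {m : ℕ} (b : ℕ) where

  below : Fin m → Bool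
  below x = ⌊ toℕ x <? b ⌋

  lowClique : Colouring m
  lowClique = record
    { col = λ x y → redIf (below x ∧ below y)
    ; sym = λ x y → cong redIf (∧-comm (below x) (below y)) }

  lowStar : Colouring m
  lowStar = record
    { col = λ x y → redIf (below x ∨ below y)
    ; sym = λ x y → cong redIf (∨-comm (below x) (below y)) }

  lowClique-red : ∀ {x y} → col lowClique x y ≡ red → toℕ x < b
  lowClique-red {x} {y} e = toWitness (redIf-∧-red (below x) (below y) e)

  lowClique-blue : ∀ {x y} → col lowClique x y ≡ blue → toℕ x < b → b ≤ toℕ y
  lowClique-blue {x} {y} e x<b = ≮⇒≥ (redIf-∧-blue (below x) (below y) e (fromWitness x<b) ∘ fromWitness)

  lowStar-red : ∀ {x y} → col lowStar x y ≡ red → toℕ x < b ⊎ toℕ y < b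
  lowStar-red {x} {y} e with redIf-∨-red (below x) (below y) e
  ... | inj₁ x-below = inj₁ (toWitness x-below)
  ... | inj₂ y-below = inj₂ (toWitness y-below)

  lowStar-blue : ∀ {x y} → col lowStar x y ≡ blue → b ≤ toℕ x
  lowStar-blue {x} {y} e = ≮⇒≥ (redIf-∨-blue (below x) (below y) e ∘ fromWitness)

  lowClique-matching : ∀ {s} → MonoCopy m lowClique red (matching s) → s * 2 ≤ b
  lowClique-matching {s} (f , f-injective , f-red) =
    injective-between⇒≤ 0 b (f ∘ enumerateMatching s) (enumerateMatching-injective s ∘ f-injective)
      (λ _ → z≤n) (below-red ∘ enumerateMatching s)
    where
    below-red : ∀ v → toℕ (f v) < b
    below-red (i , β) = lowClique-red (f-red (i , β) (i , not β) (refl , not-¬ refl))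

  module _ {t₁ n} (f : V (fan (suc t₁) n) → Fin m) (f-injective : Injective _≡_ _≡_ f)
           (f-blue : ∀ p q → fanAdj (suc t₁) n p q → col lowClique (f p) (f q) ≡ blue) where

    lowClique-fan-lowCentre : toℕ (f nothing) < b → n * suc t₁ ≤ m ∸ b
    lowClique-fan-lowCentre centre<b =
      injective-between⇒≤ b m (f ∘ just ∘ remQuot (suc t₁))
        (↔-injective (Finₚ.*↔× {n} {suc t₁}) ∘ just-injective ∘ f-injective)
        (λ x → lowClique-blue (f-blue nothing (just (remQuot (suc t₁) x)) tt) centre<b)
        (λ x → Finₚ.toℕ<n (f (just (remQuot (suc t₁) x))))

    -- Leaf a + 1 of clique i if it is high, else leaf 0, which is then high: two low leaves
    -- of one clique would span a red edge.
    representative : Fin n → Fin t₁ → Fin (suc t₁)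
    representative i a with toℕ (f (just (i , suc a))) <? b
    ... | yes _ = zero
    ... | no  _ = suc a

    representative-high : ∀ i a → b ≤ toℕ (f (just (i , representative i a)))
    representative-high i a with toℕ (f (just (i , suc a))) <? b
    ... | yes a<b = lowClique-blue (f-blue (just (i , suc a)) (just (i , zero)) (refl , λ ())) a<b
    ... | no  a≮b = ≮⇒≥ a≮b

    representative-injective : ∀ i {a a′} → representative i a ≡ representative i a′ → a ≡ a′
    representative-injective i {a} {a′} e
      with toℕ (f (just (i , suc a))) <? b | toℕ (f (just (i , suc a′))) <? b
    ... | no _    | no _     = Finₚ.suc-injective e
    ... | yes a<b | yes a′<b with a Finₚ.≟ a′
    ...   | yes a≡a′ = a≡a′
    ...   | no  a≢a′ = ⊥-elim (<⇒≱ a′<b (lowClique-blue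
              (f-blue (just (i , suc a)) (just (i , suc a′)) (refl , a≢a′ ∘ Finₚ.suc-injective)) a<b))

    withRepresentatives : V (fan t₁ n) → V (fan (suc t₁) n)
    withRepresentatives nothing        = nothing
    withRepresentatives (just (i , a)) = just (i , representative i a)

    withRepresentatives-injective : Injective _≡_ _≡_ withRepresentatives
    withRepresentatives-injective {nothing}      {nothing}       _ = refl
    withRepresentatives-injective {just (i , a)} {just (j , a′)} e with just-injective e
    ... | ia≡ja′ with cong proj₁ ia≡ja′
    ...   | refl = cong (λ a → just (i , a)) (representative-injective i (cong proj₂ ia≡ja′))

    lowClique-fan-highCentre : b ≤ toℕ (f nothing) → suc (n * t₁) ≤ m ∸ b
    lowClique-fan-highCentre b≤centre =
      injective-between⇒≤ b m (f ∘ withRepresentatives ∘ enumerateFan t₁ n)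
        (enumerateFan-injective t₁ n ∘ withRepresentatives-injective ∘ f-injective)
        (high ∘ enumerateFan t₁ n) (λ x → Finₚ.toℕ<n (f _))
      where
      high : ∀ p → b ≤ toℕ (f (withRepresentatives p))
      high nothing        = b≤centre
      high (just (i , a)) = representative-high i a

  lowClique-fan : ∀ {t₁ n} → MonoCopy m lowClique blue (fan (suc t₁) (suc n)) → suc (suc n * t₁) ≤ m ∸ b
  lowClique-fan {t₁} {n} (f , f-injective , f-blue) with toℕ (f nothing) <? b
  ... | yes centre<b = ≤-trans (s≤s (+-monoʳ-≤ t₁ (*-monoʳ-≤ n (n≤1+n t₁))))
                                (lowClique-fan-lowCentre f f-injective f-blue centre<b)
  ... | no  centre≮b = lowClique-fan-highCentre f f-injective f-blue (≮⇒≥ centre≮b)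

  lowStar-matching : ∀ {s} → MonoCopy m lowStar red (matching s) → s ≤ b
  lowStar-matching {s} (f , f-injective , f-red) =
    injective-between⇒≤ 0 b (f ∘ lowEnd) (cong proj₁ ∘ f-injective) (λ _ → z≤n) lowEnd-below
    where
    lowSide : Fin s → Bool
    lowSide i with toℕ (f (i , false)) <? b
    ... | yes _ = false
    ... | no  _ = true
    lowEnd : Fin s → V (matching s)
    lowEnd i = i , lowSide i
    lowEnd-below : ∀ i → toℕ (f (lowEnd i)) < b
    lowEnd-below i with toℕ (f (i , false)) <? b
    ... | yes false<b = false<b
    ... | no  false≮b with lowStar-red (f-red (i , false) (i , true) (refl , λ ()))
    ...   | inj₁ false<b = ⊥-elim (false≮b false<b)
    ...   | inj₂ true<b  = true<b

  lowStar-fan : ∀ {t n} → MonoCopy m lowStar blue (fan (suc t) (suc n)) → suc (suc n * suc t) ≤ m ∸ b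
  lowStar-fan {t} {n} (f , f-injective , f-blue) =
    injective-between⇒≤ b m (f ∘ enumerateFan (suc t) (suc n))
      (enumerateFan-injective (suc t) (suc n) ∘ f-injective)
      (high ∘ enumerateFan (suc t) (suc n)) (λ x → Finₚ.toℕ<n (f _))
    where
    high : ∀ p → b ≤ toℕ (f p)
    high nothing  = lowStar-blue (f-blue nothing (just (zero , zero)) tt)
    high (just p) = lowStar-blue (f-blue (just p) nothing tt)

noArrow-lowClique : ∀ s′ n′ a m → m ≤ (suc s′ + s′) + suc a * suc n′ →
                    ¬ Arrows m (matching (suc s′)) (fan (suc (suc a)) (suc n′))
noArrow-lowClique s′ n′ a m m≤ arrows = Sum.[ noRedMatching , noBlueFan ] (arrows (lowClique b))
  where
  b : ℕ
  b = suc s′ + s′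
  doubling : ∀ s′ → suc (suc s′ + s′) ≡ suc s′ * 2
  doubling = solve-∀
  noRedMatching : ¬ MonoCopy m (lowClique b) red (matching (suc s′))
  noRedMatching = <⇒≱ (≤-reflexive (doubling s′)) ∘ lowClique-matching b
  noBlueFan : ¬ MonoCopy m (lowClique b) blue (fan (suc (suc a)) (suc n′))
  noBlueFan blueFan = 1+n≰n (begin
    suc (suc a * suc n′) ≡⟨ cong suc (*-comm (suc a) (suc n′)) ⟩
    suc (suc n′ * suc a) ≤⟨ lowClique-fan b blueFan ⟩
    m ∸ b                ≤⟨ m≤n+o⇒m∸n≤o m b m≤ ⟩
    suc a * suc n′       ∎)
    where open ≤-Reasoning

noArrow-lowStar : ∀ s′ n′ a m → m ≤ s′ + suc n′ * suc (suc a) →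
                  ¬ Arrows m (matching (suc s′)) (fan (suc (suc a)) (suc n′))
noArrow-lowStar s′ n′ a m m≤ arrows = Sum.[ noRedMatching , noBlueFan ] (arrows (lowStar s′))
  where
  noRedMatching : ¬ MonoCopy m (lowStar s′) red (matching (suc s′))
  noRedMatching = 1+n≰n ∘ lowStar-matching s′
  noBlueFan : ¬ MonoCopy m (lowStar s′) blue (fan (suc (suc a)) (suc n′))
  noBlueFan blueFan = 1+n≰n (≤-trans (lowStar-fan s′ blueFan) (m≤n+o⇒m∸n≤o m s′ m≤))

lowerBound : ∀ s′ n′ a m → m < (suc s′ ⊔ suc n′) + suc a * suc n′ + suc s′ →
             ¬ Arrows m (matching (suc s′)) (fan (suc (suc a)) (suc n′))
lowerBound s′ n′ a m m<N = case suc n′ ≤? suc s′ of λ where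
    (yes n≤s) → noArrow-lowClique s′ n′ a m
                  (≤-pred (subst (m <_) (trans (cong (λ z → z + X + s) (m≥n⇒m⊔n≡m n≤s))
                                               (sizeˡ s′ X)) m<N))
    (no  n≰s) → noArrow-lowStar s′ n′ a m
                  (≤-pred (subst (m <_) (trans (cong (λ z → z + X + s) (m≤n⇒m⊔n≡n (<⇒≤ (≰⇒> n≰s))))
                                               (sizeʳ s′ n′ a)) m<N))
  where
  s X : ℕ
  s = suc s′
  X = suc a * suc n′
  sizeˡ : ∀ s′ X → suc s′ + X + suc s′ ≡ suc (suc s′ + s′ + X)
  sizeˡ = solve-∀
  sizeʳ : ∀ s′ n′ a → suc n′ + suc a * suc n′ + suc s′ ≡ suc (s′ + suc n′ * suc (suc a))
  sizeʳ = solve-∀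

lemma2p7 : (s n t : ℕ) → 1 ≤ s → 1 ≤ n → 2 ≤ t →
    IsRamseyNumber (matching s) (fan t n) ((s ⊔ n) + (t ∸ 1) * n + s)
lemma2p7 (suc s′) (suc n′) (suc (suc a)) _ _ _ = upperBound (suc s′) (suc n′) a , lowerBound s′ n′ a
lemma2p7 zero     _        _             ()
lemma2p7 (suc _)  zero     _             _ ()
lemma2p7 (suc _)  (suc _)  (suc zero)    _ _ (s≤s ())
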